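{- For every finite multiset $\Gamma$ of formulae of intuitionistic linear logic and every formula $\varphi$: if $\Gamma\Vdash\varphi$ (i.e. $\Gamma\Vdash^{\varnothing}_{\mathcal{B}}\varphi$ for every base $\mathcal{B}$), then $\Gamma\vdash\varphi$ in the natural deduction system $\mathrm{N_{ILL}}$.
   Context: Fix a set $\mathbb{A}$ of propositional atoms. All multisets are finite; $\uplus$ denotes multiset union; an atomic multiset is a finite multiset of atoms. Formulae: $\varphi ::= p\in\mathbb{A}\mid\top\mid 0\mid 1\mid\varphi\multimap\varphi\mid\varphi\otimes\varphi\mid\varphi\mathbin{\&}\varphi\mid\varphi\oplus\varphi\mid\,!\varphi$. For a multiset $\Delta=\{\delta_1,\dots,\delta_k\}$, $!\Delta=\{!\delta_1,\dots,!\delta_k\}$. Natural deduction $\mathrm{N_{ILL}}$: $\Gamma\vdash\varphi$ ($\Gamma$ a possibly empty multiset of formulae) is the smallest relation closed under: (Ax) $\varphi\vdash\varphi$; ($\multimap$I) from $\Gamma\uplus\{\varphi\}\vdash\psi$ infer $\Gamma\vdash\varphi\multimap\psi$; ($\multimap$E) from $\Gamma\vdash\varphi\multimap\psi$ and $\Delta\vdash\varphi$ infer $\Gamma\uplus\Delta\vdash\psi$; ($\otimes$I) from $\Gamma\vdash\varphi$, $\Delta\vdash\psi$ infer $\Gamma\uplus\Delta\vdash\varphi\otimes\psi$; ($\otimes$E) from $\Gamma\vdash\varphi\otimes\psi$ and $\Delta\uplus\{\varphi,\psi\}\vdash\chi$ infer $\Gamma\uplus\Delta\vdash\chi$; ($1$I)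 $\vdash 1$; ($1$E) from $\Gamma\vdash 1$, $\Delta\vdash\varphi$ infer $\Gamma\uplus\Delta\vdash\varphi$; ($\mathbin{\&}$I) from $\Gamma\vdash\varphi$, $\Gamma\vdash\psi$ infer $\Gamma\vdash\varphi\mathbin{\&}\psi$; ($\mathbin{\&}$E) from $\Gamma\vdash\varphi\mathbin{\&}\psi$ infer $\Gamma\vdash\varphi$ and also $\Gamma\vdash\psi$; ($\oplus$I) from $\Gamma\vdash\varphi$ (resp. $\Gamma\vdash\psi$) infer $\Gamma\vdash\varphi\oplus\psi$; ($\oplus$E) from $\Gamma\vdash\varphi\oplus\psi$, $\Delta\uplus\{\varphi\}\vdash\chi$, $\Delta\uplus\{\psi\}\vdash\chi$ infer $\Gamma\uplus\Delta\vdash\chi$; ($\top$I, any $n\ge0$) from $\Gamma_i\vdash\varphi_i$ ($1\le i\le n$) infer $\Gamma_1\uplus\dots\uplus\Gamma_n\vdash\top$; ($0$E, any $n\ge 0$) from $\Gamma_i\vdash\varphi_i$ ($1\le i\le n$) and $\Delta\vdash 0$ infer $\Gamma_1\uplus\dots\uplus\Gamma_n\uplus\Delta\vdash\chi$; (Prom$_n$, any $n\ge0$) from $\Gamma_i\vdash\,!\psi_i$ ($1\le i\le n$) and $\{!\psi_1,\dots,!\psi_n\}\vdash\varphi$ infer $\Gamma_1\uplus\dots\uplus\Gamma_n\vdash\,!\varphi$; (Der) from $\Gamma\vdash\,!\varphi$, $\Delta\uplus\{\varphi\}\vdash\psi$ infer $\Gamma\uplus\Delta\vdash\psi$; (Wk)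 from $\Gamma\vdash\,!\varphi$, $\Delta\vdash\psi$ infer $\Gamma\uplus\Delta\vdash\psi$; (Ctr) from $\Gamma\vdash\,!\varphi$, $\Delta\uplus\{!\varphi,!\varphi\}\vdash\psi$ infer $\Gamma\uplus\Delta\vdash\psi$. Bases. An atomic sequent is a pair $P\Rightarrow p$ ($P$ atomic multiset, $p$ atom); an atomic box is a finite multiset of atomic sequents; an atomic rule is a triple $\langle\mathbf{A},\mathbf{S},p\rangle$ with $\mathbf{A}$ a finite multiset of atomic boxes, $\mathbf{S}$ an atomic box, $p$ an atom. A base is a set of atomic rules; $\mathcal{C}\supseteq\mathcal{B}$ is set inclusion. An atom $p$ is persistent in $\mathcal{B}$ if $\mathcal{B}$ contains a rule $\langle\varnothing,\mathbf{S},p\rangle$ with $\mathbf{S}\neq\varnothing$. Derivability $P\vdash_{\mathcal{B}}p$ is the smallest relation closed under: (Ref) $\{p\}\vdash_{\mathcal{B}}p$; (App) if $\langle\mathbf{A},\mathbf{S},p\rangle\in\mathcal{B}$ with $\mathbf{A}=\{\mathbf{T}_1,\dots,\mathbf{T}_m\}$, and there are $n\ge m$, atomic multisets $C_1,\dots,C_n$ and a multiset $D=\{d_{m+1},\dots,d_n\}$ of atoms persistent in $\mathcal{B}$ with $C_i\uplus Q\vdash_{\mathcal{B}}q$ for all $i\le m$ and $Q\Rightarrow q\in\mathbf{T}_i$, $C_j\vdash_{\mathcal{B}}d_j$ for all $m<j\le n$, and $D\uplus U\vdash_{\mathcal{B}}v$ for all $U\Rightarrow v\in\mathbf{S}$,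 then $C_1\uplus\dots\uplus C_n\vdash_{\mathcal{B}}p$. Support. For a base $\mathcal{B}$, atomic multiset $L$: (At) $\Vdash^L_{\mathcal{B}}p$ iff $L\vdash_{\mathcal{B}}p$; ($\multimap$) $\Vdash^L_{\mathcal{B}}\varphi\multimap\psi$ iff $\varphi\Vdash^L_{\mathcal{B}}\psi$; ($\otimes$) $\Vdash^L_{\mathcal{B}}\varphi\otimes\psi$ iff for all $\mathcal{C}\supseteq\mathcal{B}$, atomic multisets $K$, atoms $p$: if $\{\varphi,\psi\}\Vdash^K_{\mathcal{C}}p$ then $\Vdash^{L\uplus K}_{\mathcal{C}}p$; ($1$) $\Vdash^L_{\mathcal{B}}1$ iff for all $\mathcal{C}\supseteq\mathcal{B}$, $K$, $p$: if $\Vdash^K_{\mathcal{C}}p$ then $\Vdash^{L\uplus K}_{\mathcal{C}}p$; ($\mathbin{\&}$) $\Vdash^L_{\mathcal{B}}\varphi\mathbin{\&}\psi$ iff $\Vdash^L_{\mathcal{B}}\varphi$ and $\Vdash^L_{\mathcal{B}}\psi$; ($\oplus$) $\Vdash^L_{\mathcal{B}}\varphi\oplus\psi$ iff for all $\mathcal{C}\supseteq\mathcal{B}$, $K$, $p$: if $\varphi\Vdash^K_{\mathcal{C}}p$ and $\psi\Vdash^K_{\mathcal{C}}p$ then $\Vdash^{L\uplus K}_{\mathcal{C}}p$; ($0$) $\Vdash^L_{\mathcal{B}}0$ iff $\Vdash^{L\uplus K}_{\mathcal{B}}p$ for all atoms $p$ and atomic multisets $K$; ($\top$) $\Vdash^L_{\mathcal{B}}\top$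 always; ($!$) $\Vdash^L_{\mathcal{B}}\,!\varphi$ iff for all $\mathcal{C}\supseteq\mathcal{B}$, $K$, $p$: if (for all $\mathcal{D}\supseteq\mathcal{C}$, $\Vdash^{\varnothing}_{\mathcal{D}}\varphi$ implies $\Vdash^K_{\mathcal{D}}p$) then $\Vdash^{L\uplus K}_{\mathcal{C}}p$. Multisets: $\Vdash^L_{\mathcal{B}}\varnothing$ iff $L=\varnothing$; $\Vdash^L_{\mathcal{B}}\{\varphi\}$ iff $\Vdash^L_{\mathcal{B}}\varphi$; $\Vdash^L_{\mathcal{B}}\Gamma\uplus\Delta$ iff $L=K\uplus M$ for some $K,M$ with $\Vdash^K_{\mathcal{B}}\Gamma$, $\Vdash^M_{\mathcal{B}}\Delta$. (Inf) For non-empty $\Gamma$, write $\Gamma=\,!\Delta\uplus\Theta$ with $!\Delta$ the elements whose top-level connective is $!$ and $\Theta$ the rest; $\Gamma\Vdash^L_{\mathcal{B}}\varphi$ iff for all $\mathcal{C}\supseteq\mathcal{B}$ and atomic $K$: if $\Vdash^{\varnothing}_{\mathcal{C}}\delta$ for every $\delta\in\Delta$ and $\Vdash^K_{\mathcal{C}}\Theta$, then $\Vdash^{L\uplus K}_{\mathcal{C}}\varphi$. For $\Gamma=\varnothing$, $\Gamma\Vdash^L_{\mathcal{B}}\varphi$ means $\Vdash^L_{\mathcal{B}}\varphi$. Validity: $\Gamma\Vdash\varphi$ iff $\Gamma\Vdash^{\varnothing}_{\mathcal{B}}\varphi$ for every base $\mathcal{B}$. -}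

module Defs where

open import Level using (Level; Lift) renaming (suc to lsuc; zero to lzero)
open import Data.Nat using (ℕ)
open import Data.Unit using (⊤)
open import Data.Product using (Σ; _×_; _,_; proj₁; proj₂)
open import Data.List using (List; []; _∷_; [_]; _++_; concat; map)
open import Data.List.Relation.Unary.All using (All)
open import Data.List.Relation.Binary.Pointwise using (Pointwise)
open import Data.List.Membership.Propositional using (_∈_)
open import Data.List.Relation.Binary.Permutation.Propositional using (_↭_)
open import Relation.Binary.PropositionalEquality using (_≢_)
open import Relation.Unary using (Pred; _⊆_)

-- Conventions
--   * Atoms: the set 𝔸 of propositional atoms is ℕ (countably infinite).
--   * Finite multisets are represented by lists; multiset equality is the
--     permutation relation _↭_ and multiset union ⊎ is list append _++_.
--     Every derivability relation below is closed under permutation of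
--     its context, so it is really a relation on multisets.

Atom : Set
Atom = ℕ

infixr 30 _⊸_
infixr 35 _⊕_
infixr 36 _&_
infixr 37 _⊗_
infix  40 !_

data Formula : Set where
  atom : Atom → Formula
  ⊤ᶠ   : Formula
  𝟘    : Formula
  𝟙    : Formula
  _⊸_  : Formula → Formula → Formula
  _⊗_  : Formula → Formula → Formula
  _&_  : Formula → Formula → Formula
  _⊕_  : Formula → Formula → Formula
  !_   : Formula → Formula

infix 10 _⊢_

data _⊢_ : List Formula → Formula → Set where
  exch  : ∀ {Γ Δ φ} → Γ ↭ Δ → Γ ⊢ φ → Δ ⊢ φ
  ax    : ∀ {φ} → [ φ ] ⊢ φ
  ⊸I    : ∀ {Γ φ ψ} → (φ ∷ Γ) ⊢ ψ → Γ ⊢ φ ⊸ ψ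
  ⊸E    : ∀ {Γ Δ φ ψ} → Γ ⊢ φ ⊸ ψ → Δ ⊢ φ → (Γ ++ Δ) ⊢ ψ
  ⊗I    : ∀ {Γ Δ φ ψ} → Γ ⊢ φ → Δ ⊢ ψ → (Γ ++ Δ) ⊢ φ ⊗ ψ
  ⊗E    : ∀ {Γ Δ φ ψ χ} → Γ ⊢ φ ⊗ ψ → (φ ∷ ψ ∷ Δ) ⊢ χ → (Γ ++ Δ) ⊢ χ
  𝟙I    : [] ⊢ 𝟙
  𝟙E    : ∀ {Γ Δ φ} → Γ ⊢ 𝟙 → Δ ⊢ φ → (Γ ++ Δ) ⊢ φ
  &I    : ∀ {Γ φ ψ} → Γ ⊢ φ → Γ ⊢ ψ → Γ ⊢ φ & ψ
  &E₁   : ∀ {Γ φ ψ} → Γ ⊢ φ & ψ → Γ ⊢ φ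
  &E₂   : ∀ {Γ φ ψ} → Γ ⊢ φ & ψ → Γ ⊢ ψ
  ⊕I₁   : ∀ {Γ φ ψ} → Γ ⊢ φ → Γ ⊢ φ ⊕ ψ
  ⊕I₂   : ∀ {Γ φ ψ} → Γ ⊢ ψ → Γ ⊢ φ ⊕ ψ
  ⊕E    : ∀ {Γ Δ φ ψ χ} → Γ ⊢ φ ⊕ ψ → (φ ∷ Δ) ⊢ χ → (ψ ∷ Δ) ⊢ χ → (Γ ++ Δ) ⊢ χ
  -- premises Γᵢ ⊢ φᵢ  (i = 1..n) given as a list of pairs (Γᵢ , φᵢ)
  ⊤I    : (ps : List (List Formula × Formula)) →
          All (λ p → proj₁ p ⊢ proj₂ p) ps →
          concat (map proj₁ ps) ⊢ ⊤ᶠ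
  𝟘E    : ∀ {Δ χ} (ps : List (List Formula × Formula)) →
          All (λ p → proj₁ p ⊢ proj₂ p) ps →
          Δ ⊢ 𝟘 →
          (concat (map proj₁ ps) ++ Δ) ⊢ χ
  prom  : ∀ {φ} (ps : List (List Formula × Formula)) →
          All (λ p → proj₁ p ⊢ ! proj₂ p) ps →
          map (λ p → ! proj₂ p) ps ⊢ φ →
          concat (map proj₁ ps) ⊢ ! φ
  der   : ∀ {Γ Δ φ ψ} → Γ ⊢ ! φ → (φ ∷ Δ) ⊢ ψ → (Γ ++ Δ) ⊢ ψ
  wk    : ∀ {Γ Δ φ ψ} → Γ ⊢ ! φ → Δ ⊢ ψ → (Γ ++ Δ) ⊢ ψ
  ctr   : ∀ {Γ Δ φ ψ} → Γ ⊢ ! φ → (! φ ∷ ! φ ∷ Δ) ⊢ ψ → (Γ ++ Δ) ⊢ ψ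

AtMS : Set
AtMS = List Atom

Sequent : Set
Sequent = AtMS × Atom

Box : Set
Box = List Sequent

record Rule : Set where
  constructor ⟨_,_,_⟩
  field
    boxes : List Box
    side  : Box
    head  : Atom

Base : Set₁
Base = Pred Rule lzero

Persistent : Base → Atom → Set
Persistent ℬ p = Σ Box λ S → (S ≢ []) × ℬ ⟨ [] , S , p ⟩

data Der (ℬ : Base) : AtMS → Atom → Set₁ where
  ref : ∀ {L p} → L ↭ [ p ] → Der ℬ L p
  app : ∀ {L A S p}
        (Cs : List AtMS)                     -- C₁ … Cₘ, paired with 𝐓₁ … 𝐓ₘ
        (extra : List (AtMS × Atom)) →       -- (C_j , d_j) for m < j ≤ n
        ℬ ⟨ A , S , p ⟩ →
        Pointwise (λ C T → ∀ {Q q} → (Q , q) ∈ T → Der ℬ (C ++ Q) q) Cs A →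
        All (λ e → Persistent ℬ (proj₂ e) × Der ℬ (proj₁ e) (proj₂ e)) extra →
        (∀ {U v} → (U , v) ∈ S → Der ℬ (map proj₂ extra ++ U) v) →
        L ↭ (concat Cs ++ concat (map proj₁ extra)) →
        Der ℬ L p

-- An element of a context, seen through its support predicate:
--   bang P  : the element is !δ, and P 𝒞 means ⊩^∅_𝒞 δ
--   plain P : the element is not a !-formula, and P 𝒞 K means ⊩^K_𝒞 it
data Item : Set₂ where
  bang  : (Base → Set₁) → Item
  plain : (Base → AtMS → Set₁) → Item

bangs : List Item → List (Base → Set₁)
bangs []             = []
bangs (bang P ∷ xs)  = P ∷ bangs xs
bangs (plain _ ∷ xs) = bangs xs

plains : List Item → List (Base → AtMS → Set₁)
plains []             = []
plains (bang _ ∷ xs)  = plains xs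
plains (plain P ∷ xs) = P ∷ plains xs

AllBang : List (Base → Set₁) → Base → Set₁
AllBang []       𝒞 = Lift (lsuc lzero) ⊤
AllBang (P ∷ Ps) 𝒞 = P 𝒞 × AllBang Ps 𝒞

CtxSupp : List (Base → AtMS → Set₁) → Base → AtMS → Set₁
CtxSupp []            𝒞 K = Lift (lsuc lzero) (K ↭ [])
CtxSupp (P ∷ [])      𝒞 K = P 𝒞 K
CtxSupp (P ∷ Q ∷ Θ)   𝒞 K =
  Σ AtMS λ K₁ → Σ AtMS λ M → Lift (lsuc lzero) (K ↭ (K₁ ++ M)) × P 𝒞 K₁ × CtxSupp (Q ∷ Θ) 𝒞 M

-- (Inf):  Γ ⊩^L_ℬ χ  where concl 𝒞 K means ⊩^K_𝒞 χ
InfG : List Item → (Base → AtMS → Set₁) → Base → AtMS → Set₁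
InfG []         concl ℬ L = concl ℬ L
InfG Γ@(_ ∷ _)  concl ℬ L =
  ∀ (𝒞 : Base) → ℬ ⊆ 𝒞 → ∀ (K : AtMS) →
  AllBang (bangs Γ) 𝒞 →
  CtxSupp (plains Γ) 𝒞 K →
  concl 𝒞 (L ++ K)

mutual
  Supp : Base → AtMS → Formula → Set₁
  Supp ℬ L (atom p) = Der ℬ L p
  Supp ℬ L (φ ⊸ ψ)  = InfG (item φ ∷ []) (λ 𝒞 K → Supp 𝒞 K ψ) ℬ L
  Supp ℬ L (φ ⊗ ψ)  =
    ∀ (𝒞 : Base) → ℬ ⊆ 𝒞 → ∀ (K : AtMS) (p : Atom) →
    InfG (item φ ∷ item ψ ∷ []) (λ 𝒟 K' → Der 𝒟 K' p) 𝒞 K →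
    Der 𝒞 (L ++ K) p
  Supp ℬ L 𝟙 =
    ∀ (𝒞 : Base) → ℬ ⊆ 𝒞 → ∀ (K : AtMS) (p : Atom) →
    Der 𝒞 K p → Der 𝒞 (L ++ K) p
  Supp ℬ L (φ & ψ) = Supp ℬ L φ × Supp ℬ L ψ
  Supp ℬ L (φ ⊕ ψ) =
    ∀ (𝒞 : Base) → ℬ ⊆ 𝒞 → ∀ (K : AtMS) (p : Atom) →
    InfG (item φ ∷ []) (λ 𝒟 K' → Der 𝒟 K' p) 𝒞 K →
    InfG (item ψ ∷ []) (λ 𝒟 K' → Der 𝒟 K' p) 𝒞 K →
    Der 𝒞 (L ++ K) p
  Supp ℬ L 𝟘 = ∀ (p : Atom) (K : AtMS) → Der ℬ (L ++ K) p
  Supp ℬ L ⊤ᶠ = Lift (lsuc lzero) ⊤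
  Supp ℬ L (! φ) =
    ∀ (𝒞 : Base) → ℬ ⊆ 𝒞 → ∀ (K : AtMS) (p : Atom) →
    (∀ (𝒟 : Base) → 𝒞 ⊆ 𝒟 → Supp 𝒟 [] φ → Der 𝒟 K p) →
    Der 𝒞 (L ++ K) p

  item : Formula → Item
  item (! δ) = bang (λ 𝒞 → Supp 𝒞 [] δ)
  item φ     = plain (λ 𝒞 K → Supp 𝒞 K φ)

Inf : Base → AtMS → List Formula → Formula → Set₁
Inf ℬ L Γ φ = InfG (map item Γ) (λ 𝒞 K → Supp 𝒞 K φ) ℬ L

Valid : List Formula → Formula → Set₁
Valid Γ φ = ∀ (ℬ : Base) → Inf ℬ [] Γ φ

-- Completeness via a simulation base 𝒮: each compound subformula χ of Γ, φ is named by a fresh atom χ♭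
-- and every rule of N_ILL becomes an atomic rule on these atoms, so that derivations in 𝒮 decode to
-- N_ILL derivations. By induction on χ, in every base extending 𝒮, support of χ coincides with
-- derivability of χ♭. For !δ this goes through the extension by the axiom ⇒ δ♭: its uses are traded
-- for a single hypothesis (!δ)♭ by dereliction, weakening and contraction. Instantiating Γ ⊩ φ at 𝒮
-- then gives Γ♭ ⊢_𝒮 φ♭, which decodes to Γ ⊢ φ.

module Submission where

open import Defs
open import Level using (Lift; lift) renaming (suc to lsuc; zero to lzero)
open import Data.Nat using (ℕ; zero; suc; _+_; _∸_; _≤_; _⊔_; s≤s) renaming (_≟_ to _≟ℕ_)
open import Data.Nat.Properties using (m+n≮m; m+n∸m≡n; m≤m⊔n; m≤n⊔m; ≤-trans; _<?_)
open import Data.Unit using (tt) renaming (⊤ to Unit)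
open import Data.Empty using (⊥-elim)
open import Data.Product using (Σ; _×_; _,_; proj₁; proj₂)
open import Data.Sum using (_⊎_; inj₁; inj₂)
open import Data.List using (List; []; _∷_; [_]; _++_; concat; map; replicate; length; concatMap)
open import Data.List.Properties
  using (map-++; map-∘; ++-assoc; ++-identityʳ; concat-map-[_]; ∷-injectiveˡ; ≡-dec)
open import Data.List.Relation.Unary.All using (All; []; _∷_)
import Data.List.Relation.Unary.All as All
open import Data.List.Relation.Unary.Any using (here; there)
open import Data.List.Relation.Binary.Pointwise using (Pointwise; []; _∷_)
open import Data.List.Membership.Propositional using (_∈_)
open import Data.List.Membership.Propositional.Properties using (∈-++⁺ˡ; ∈-++⁺ʳ)
open import Data.List.Relation.Binary.Permutation.Propositional
  using (_↭_; ↭-refl; ↭-sym; ↭-trans; ↭-reflexive; prep; module PermutationReasoning)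
open import Data.List.Relation.Binary.Permutation.Propositional.Properties
  using (map⁺; shift; shifts; ++-commutativeMonoid; ++⁺ˡ; ++⁺ʳ) renaming (++-comm to ↭-++-comm)
open import Relation.Binary.Definitions using (DecidableEquality)
open import Relation.Binary.PropositionalEquality
  using (_≡_; refl; sym; trans; cong; cong₂; subst; subst₂; module ≡-Reasoning)
open import Relation.Nullary using (yes; no)
open import Relation.Nullary.Decidable using (map′)
open import Relation.Unary using (_⊆_)
import Algebra.Solver.CommutativeMonoid as CommutativeMonoidSolver

open CommutativeMonoidSolver (++-commutativeMonoid {A = Atom}) using (solve; _⊜_) renaming (_⊕_ to _∪_)

Der-↭ : ∀ {ℬ L M p} → Der ℬ L p → L ↭ M → Der ℬ M p
Der-↭ (ref e) π = ref (↭-trans (↭-sym π) e)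
Der-↭ (app Cs ex r pw al sc e) π = app Cs ex r pw al sc (↭-trans (↭-sym π) e)

Der-++[]⁺ : ∀ {ℬ L p} → Der ℬ L p → Der ℬ (L ++ []) p
Der-++[]⁺ {L = L} d = Der-↭ d (↭-reflexive (sym (++-identityʳ L)))

Der-++[]⁻ : ∀ {ℬ L p} → Der ℬ (L ++ []) p → Der ℬ L p
Der-++[]⁻ {L = L} d = Der-↭ d (↭-reflexive (++-identityʳ L))

BoxDer : Base → AtMS → Box → Set₁
BoxDer ℬ C T = ∀ {Q q} → (Q , q) ∈ T → Der ℬ (C ++ Q) q

PersistentDer : Base → AtMS × Atom → Set₁
PersistentDer ℬ e = Persistent ℬ (proj₂ e) × Der ℬ (proj₁ e) (proj₂ e)

mutual
  Der-mono : ∀ {ℬ 𝒞 L p} → ℬ ⊆ 𝒞 → Der ℬ L p → Der 𝒞 L p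
  Der-mono s (ref e) = ref e
  Der-mono s (app Cs ex r pw al sc e) =
    app Cs ex (s r) (BoxDers-mono s pw) (PersistentDers-mono s al) (λ m → Der-mono s (sc m)) e

  BoxDers-mono : ∀ {ℬ 𝒞 Cs A} → ℬ ⊆ 𝒞 → Pointwise (BoxDer ℬ) Cs A → Pointwise (BoxDer 𝒞) Cs A
  BoxDers-mono s [] = []
  BoxDers-mono s (f ∷ pw) = (λ m → Der-mono s (f m)) ∷ BoxDers-mono s pw

  PersistentDers-mono : ∀ {ℬ 𝒞 ex} → ℬ ⊆ 𝒞 → All (PersistentDer ℬ) ex → All (PersistentDer 𝒞) ex
  PersistentDers-mono s [] = []
  PersistentDers-mono s (((S , S≢[] , r) , d) ∷ al) = ((S , S≢[] , s r) , Der-mono s d) ∷ PersistentDers-mono s al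

⇒_ : Atom → Box
⇒ a = [ ([] , a) ]

singleBox : ∀ {ℬ C Q q} → Der ℬ (C ++ Q) q → BoxDer ℬ C [ (Q , q) ]
singleBox d (here refl) = d

app₁ : ∀ {ℬ C Q q p} → ℬ ⟨ [ [ (Q , q) ] ] , [] , p ⟩ → Der ℬ (C ++ Q) q → Der ℬ C p
app₁ {C = C} r d =
  app (C ∷ []) [] r (singleBox d ∷ []) [] (λ ()) (↭-reflexive (sym (trans (++-identityʳ _) (++-identityʳ C))))

app₂ : ∀ {ℬ C₁ C₂ Q₁ Q₂ q₁ q₂ p} → ℬ ⟨ [ (Q₁ , q₁) ] ∷ [ (Q₂ , q₂) ] ∷ [] , [] , p ⟩ →
       Der ℬ (C₁ ++ Q₁) q₁ → Der ℬ (C₂ ++ Q₂) q₂ → Der ℬ (C₁ ++ C₂) p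
app₂ {C₁ = C₁} {C₂} r d₁ d₂ =
  app (C₁ ∷ C₂ ∷ []) [] r (singleBox d₁ ∷ singleBox d₂ ∷ []) [] (λ ())
      (↭-reflexive (sym (trans (++-identityʳ _) (cong (C₁ ++_) (++-identityʳ C₂)))))

withAxiom : Base → Atom → Base
withAxiom ℬ a r = ℬ r ⊎ (r ≡ ⟨ [] , [] , a ⟩)

axiom : ∀ {ℬ a} → Der (withAxiom ℬ a) [] a
axiom = app [] [] (inj₂ refl) [] [] (λ ()) ↭-refl

persistent-withAxiom : ∀ {ℬ a d} → Persistent (withAxiom ℬ a) d → Persistent ℬ d
persistent-withAxiom (S , S≢[] , inj₁ r) = S , S≢[] , r
persistent-withAxiom (_ , S≢[] , inj₂ refl) = ⊥-elim (S≢[] refl)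

weaken-bangs : ∀ {Γ χ} ps → All (λ p → proj₁ p ⊢ ! proj₂ p) ps → Γ ⊢ χ →
               (Γ ++ concat (map proj₁ ps)) ⊢ χ
weaken-bangs {Γ} [] [] d = exch (↭-reflexive (sym (++-identityʳ Γ))) d
weaken-bangs {Γ} ((Δ , _) ∷ ps) (g ∷ gs) d = exch (shifts Δ Γ) (wk g (weaken-bangs ps gs d))

-- The simulation base

module Simulation (code : Formula → Atom) (decode : Atom → Formula) where

  flat : Formula → Atom
  flat (atom p) = p
  flat χ = code χ

  Decodes : Formula → Set
  Decodes χ = decode (flat χ) ≡ χ

  mutual
    Decodable : Formula → Set
    Decodable χ = Decodes χ × DecodableParts χ

    DecodableParts : Formula → Set
    DecodableParts (φ ⊸ ψ) = Decodable φ × Decodable ψ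
    DecodableParts (φ ⊗ ψ) = Decodable φ × Decodable ψ
    DecodableParts (φ & ψ) = Decodable φ × Decodable ψ
    DecodableParts (φ ⊕ ψ) = Decodable φ × Decodable ψ
    DecodableParts (! φ)   = Decodable φ
    DecodableParts _       = Unit

  data BoxRule : List Box → Atom → Set where
    ⊸I♭  : ∀ φ ψ → Decodable (φ ⊸ ψ) → BoxRule [ [ ([ flat φ ] , flat ψ) ] ] (flat (φ ⊸ ψ))
    ⊸E♭  : ∀ φ ψ → Decodable (φ ⊸ ψ) → BoxRule (⇒ flat (φ ⊸ ψ) ∷ ⇒ flat φ ∷ []) (flat ψ)
    ⊗I♭  : ∀ φ ψ → Decodable (φ ⊗ ψ) → BoxRule (⇒ flat φ ∷ ⇒ flat ψ ∷ []) (flat (φ ⊗ ψ))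
    ⊗E♭  : ∀ φ ψ p → Decodable (φ ⊗ ψ) →
           BoxRule (⇒ flat (φ ⊗ ψ) ∷ [ (flat φ ∷ flat ψ ∷ [] , p) ] ∷ []) p
    𝟙I♭  : Decodable 𝟙 → BoxRule [] (flat 𝟙)
    𝟙E♭  : ∀ p → Decodable 𝟙 → BoxRule (⇒ flat 𝟙 ∷ ⇒ p ∷ []) p
    &I♭  : ∀ φ ψ → Decodable (φ & ψ) → BoxRule [ ([] , flat φ) ∷ ([] , flat ψ) ∷ [] ] (flat (φ & ψ))
    &E₁♭ : ∀ φ ψ → Decodable (φ & ψ) → BoxRule [ ⇒ flat (φ & ψ) ] (flat φ)
    &E₂♭ : ∀ φ ψ → Decodable (φ & ψ) → BoxRule [ ⇒ flat (φ & ψ) ] (flat ψ)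
    ⊕I₁♭ : ∀ φ ψ → Decodable (φ ⊕ ψ) → BoxRule [ ⇒ flat φ ] (flat (φ ⊕ ψ))
    ⊕I₂♭ : ∀ φ ψ → Decodable (φ ⊕ ψ) → BoxRule [ ⇒ flat ψ ] (flat (φ ⊕ ψ))
    ⊕E♭  : ∀ φ ψ p → Decodable (φ ⊕ ψ) →
           BoxRule (⇒ flat (φ ⊕ ψ) ∷ (([ flat φ ] , p) ∷ ([ flat ψ ] , p) ∷ []) ∷ []) p
    𝟘E♭  : ∀ qs p → Decodable 𝟘 → BoxRule (⇒ flat 𝟘 ∷ map ⇒_ qs) p
    ⊤I♭  : ∀ qs → Decodable ⊤ᶠ → BoxRule (map ⇒_ qs) (flat ⊤ᶠ)
    der♭ : ∀ φ p → Decodable (! φ) → BoxRule (⇒ flat (! φ) ∷ [ ([ flat φ ] , p) ] ∷ []) p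
    wk♭  : ∀ φ p → Decodable (! φ) → BoxRule (⇒ flat (! φ) ∷ ⇒ p ∷ []) p
    ctr♭ : ∀ φ p → Decodable (! φ) →
           BoxRule (⇒ flat (! φ) ∷ [ (flat (! φ) ∷ flat (! φ) ∷ [] , p) ] ∷ []) p
    cut♭ : ∀ φ p → Decodable φ → BoxRule (⇒ flat φ ∷ [ ([ flat φ ] , p) ] ∷ []) p

  -- Promotion is the only rule with a non-empty side box, so the persistent atoms of 𝒮 are the (!φ)♭.
  data 𝒮 : Base where
    box  : ∀ {A p} → BoxRule A p → 𝒮 ⟨ A , [] , p ⟩
    prom : ∀ φ → Decodable (! φ) → 𝒮 ⟨ [] , ⇒ flat φ , flat (! φ) ⟩

  persistent-𝒮 : ∀ {d} → Persistent 𝒮 d → Σ Formula λ ψ → decode d ≡ ! ψ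
  persistent-𝒮 (_ , S≢[] , box _) = ⊥-elim (S≢[] refl)
  persistent-𝒮 (_ , _ , prom φ (o , _)) = φ , o

  decodeAll : AtMS → List Formula
  decodeAll = map decode

  decodeAll-concat₂ : ∀ C₁ C₂ → decodeAll C₁ ++ decodeAll C₂ ≡ decodeAll (C₁ ++ C₂ ++ [])
  decodeAll-concat₂ C₁ C₂ = begin
    decodeAll C₁ ++ decodeAll C₂         ≡⟨ cong (λ X → decodeAll C₁ ++ decodeAll X) (++-identityʳ C₂) ⟨
    decodeAll C₁ ++ decodeAll (C₂ ++ []) ≡⟨ map-++ decode C₁ (C₂ ++ []) ⟨
    decodeAll (C₁ ++ C₂ ++ [])           ∎
    where open ≡-Reasoning

  conclude₁ : ∀ C {χ p} → decode p ≡ χ → decodeAll C ⊢ χ → decodeAll (C ++ []) ⊢ decode p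
  conclude₁ C o d = subst₂ _⊢_ (cong decodeAll (sym (++-identityʳ C))) (sym o) d

  conclude₂ : ∀ C₁ C₂ {χ p} → decode p ≡ χ → (decodeAll C₁ ++ decodeAll C₂) ⊢ χ →
              decodeAll (C₁ ++ C₂ ++ []) ⊢ decode p
  conclude₂ C₁ C₂ o d = subst₂ _⊢_ (decodeAll-concat₂ C₁ C₂) (sym o) d

  Derivations : List Formula → Set
  Derivations Γ = Σ (List (List Formula × Formula)) λ ps →
    All (λ p → proj₁ p ⊢ proj₂ p) ps × concat (map proj₁ ps) ≡ Γ

  BangDerivations : List Formula → List Formula → Set
  BangDerivations Γ Θ = Σ (List (List Formula × Formula)) λ ps →
    All (λ p → proj₁ p ⊢ ! proj₂ p) ps × map (λ p → ! proj₂ p) ps ≡ Θ × concat (map proj₁ ps) ≡ Γ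

  mutual
    sound : ∀ {L p} → Der 𝒮 L p → decodeAll L ⊢ decode p
    sound (ref e) = exch (map⁺ decode (↭-sym e)) ax
    sound (app Cs ex (box r) pw al _ e) with sound-persistent al
    ... | ps , gs , _ , e₂ = exch (map⁺ decode (↭-sym e))
      (subst (_⊢ _) (trans (cong (decodeAll (concat Cs) ++_) e₂) (sym (map-++ decode (concat Cs) _)))
        (weaken-bangs ps gs (sound-box r pw)))
    sound (app [] ex (prom φ (o , cφ)) [] al sc e) with sound-persistent al
    ... | ps , gs , e₁ , e₂ = exch (map⁺ decode (↭-sym e))
      (subst₂ _⊢_ e₂ (sym o) (prom ps gs
        (subst₂ _⊢_ (trans (cong decodeAll (++-identityʳ _)) (sym e₁)) (proj₁ cφ) (sound (sc (here refl))))))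

    sound-premise : ∀ {C T Q q Φ χ} → BoxDer 𝒮 C T → (Q , q) ∈ T → decodeAll Q ≡ Φ → decode q ≡ χ →
                    (Φ ++ decodeAll C) ⊢ χ
    sound-premise {C} {Q = Q} f m refl refl =
      exch (↭-trans (↭-reflexive (map-++ decode C Q)) (↭-++-comm (decodeAll C) (decodeAll Q))) (sound (f m))

    sound-persistent : ∀ {ex} → All (PersistentDer 𝒮) ex →
                       BangDerivations (decodeAll (concat (map proj₁ ex))) (decodeAll (map proj₂ ex))
    sound-persistent [] = [] , [] , refl , refl
    sound-persistent {(C , _) ∷ ex} ((pers , dd) ∷ al) with persistent-𝒮 pers | sound-persistent al
    ... | ψ , eψ | ps , gs , e₁ , e₂ =
      ((decodeAll C , ψ) ∷ ps) , (subst (decodeAll C ⊢_) eψ (sound dd) ∷ gs) , cong₂ _∷_ (sym eψ) e₁ ,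
      trans (cong (decodeAll C ++_) e₂) (sym (map-++ decode C _))

    sound-premises : ∀ {Cs} qs → Pointwise (BoxDer 𝒮) Cs (map ⇒_ qs) → Derivations (decodeAll (concat Cs))
    sound-premises [] [] = [] , [] , refl
    sound-premises {C ∷ Cs} (q ∷ qs) (f ∷ pw) with sound-premises qs pw
    ... | ps , gs , e = ((decodeAll C , decode q) ∷ ps) , (sound-premise f (here refl) refl refl ∷ gs) ,
                        trans (cong (decodeAll C ++_) e) (sym (map-++ decode C (concat Cs)))

    sound-box : ∀ {A p Cs} → BoxRule A p → Pointwise (BoxDer 𝒮) Cs A → decodeAll (concat Cs) ⊢ decode p
    sound-box {Cs = C ∷ Cs} (𝟘E♭ qs p (o , _)) (f ∷ pw) with sound-premises qs pw
    ... | ps , gs , e = exch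
      (↭-trans (↭-++-comm (concat (map proj₁ ps)) (decodeAll C))
               (↭-reflexive (trans (cong (decodeAll C ++_) e) (sym (map-++ decode C (concat Cs))))))
      (𝟘E ps gs (sound-premise f (here refl) refl o))
    sound-box (⊤I♭ qs (o , _)) pw with sound-premises qs pw
    ... | ps , gs , e = subst₂ _⊢_ e (sym o) (⊤I ps gs)
    sound-box {Cs = C ∷ []} (⊸I♭ φ ψ (o , cφ , cψ)) (f ∷ []) =
      conclude₁ C o (⊸I (sound-premise f (here refl) (cong [_] (proj₁ cφ)) (proj₁ cψ)))
    sound-box {Cs = C₁ ∷ C₂ ∷ []} (⊸E♭ φ ψ (o , cφ , cψ)) (f₁ ∷ f₂ ∷ []) =
      conclude₂ C₁ C₂ (proj₁ cψ) (⊸E (sound-premise f₁ (here refl) refl o)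
                                      (sound-premise f₂ (here refl) refl (proj₁ cφ)))
    sound-box {Cs = C₁ ∷ C₂ ∷ []} (⊗I♭ φ ψ (o , cφ , cψ)) (f₁ ∷ f₂ ∷ []) =
      conclude₂ C₁ C₂ o (⊗I (sound-premise f₁ (here refl) refl (proj₁ cφ))
                             (sound-premise f₂ (here refl) refl (proj₁ cψ)))
    sound-box {Cs = C₁ ∷ C₂ ∷ []} (⊗E♭ φ ψ p (o , cφ , cψ)) (f₁ ∷ f₂ ∷ []) =
      conclude₂ C₁ C₂ refl (⊗E (sound-premise f₁ (here refl) refl o)
        (sound-premise f₂ (here refl) (cong₂ (λ x y → x ∷ y ∷ []) (proj₁ cφ) (proj₁ cψ)) refl))
    sound-box (𝟙I♭ (o , _)) [] = subst ([] ⊢_) (sym o) 𝟙I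
    sound-box {Cs = C₁ ∷ C₂ ∷ []} (𝟙E♭ p (o , _)) (f₁ ∷ f₂ ∷ []) =
      conclude₂ C₁ C₂ refl (𝟙E (sound-premise f₁ (here refl) refl o)
                                (sound-premise f₂ (here refl) refl refl))
    sound-box {Cs = C ∷ []} (&I♭ φ ψ (o , cφ , cψ)) (f ∷ []) =
      conclude₁ C o (&I (sound-premise f (here refl) refl (proj₁ cφ))
                        (sound-premise f (there (here refl)) refl (proj₁ cψ)))
    sound-box {Cs = C ∷ []} (&E₁♭ φ ψ (o , cφ , _)) (f ∷ []) =
      conclude₁ C (proj₁ cφ) (&E₁ (sound-premise f (here refl) refl o))
    sound-box {Cs = C ∷ []} (&E₂♭ φ ψ (o , _ , cψ)) (f ∷ []) =
      conclude₁ C (proj₁ cψ) (&E₂ (sound-premise f (here refl) refl o))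
    sound-box {Cs = C ∷ []} (⊕I₁♭ φ ψ (o , cφ , _)) (f ∷ []) =
      conclude₁ C o (⊕I₁ (sound-premise f (here refl) refl (proj₁ cφ)))
    sound-box {Cs = C ∷ []} (⊕I₂♭ φ ψ (o , _ , cψ)) (f ∷ []) =
      conclude₁ C o (⊕I₂ (sound-premise f (here refl) refl (proj₁ cψ)))
    sound-box {Cs = C₁ ∷ C₂ ∷ []} (⊕E♭ φ ψ p (o , cφ , cψ)) (f₁ ∷ f₂ ∷ []) =
      conclude₂ C₁ C₂ refl (⊕E (sound-premise f₁ (here refl) refl o)
        (sound-premise f₂ (here refl) (cong [_] (proj₁ cφ)) refl)
        (sound-premise f₂ (there (here refl)) (cong [_] (proj₁ cψ)) refl))
    sound-box {Cs = C₁ ∷ C₂ ∷ []} (der♭ φ p (o , cφ)) (f₁ ∷ f₂ ∷ []) =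
      conclude₂ C₁ C₂ refl (der (sound-premise f₁ (here refl) refl o)
                                (sound-premise f₂ (here refl) (cong [_] (proj₁ cφ)) refl))
    sound-box {Cs = C₁ ∷ C₂ ∷ []} (wk♭ φ p (o , _)) (f₁ ∷ f₂ ∷ []) =
      conclude₂ C₁ C₂ refl (wk (sound-premise f₁ (here refl) refl o)
                               (sound-premise f₂ (here refl) refl refl))
    sound-box {Cs = C₁ ∷ C₂ ∷ []} (ctr♭ φ p (o , _)) (f₁ ∷ f₂ ∷ []) =
      conclude₂ C₁ C₂ refl (ctr (sound-premise f₁ (here refl) refl o)
                                (sound-premise f₂ (here refl) (cong₂ (λ x y → x ∷ y ∷ []) o o) refl))
    sound-box {Cs = C₁ ∷ C₂ ∷ []} (cut♭ φ p (o , _)) (f₁ ∷ f₂ ∷ []) =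
      conclude₂ C₁ C₂ refl (exch (↭-++-comm (decodeAll C₂) (decodeAll C₁))
        (⊸E (⊸I (sound-premise f₂ (here refl) (cong [_] o) refl)) (sound-premise f₁ (here refl) refl o)))

  module AxiomElimination (𝒟 : Base) (𝒮⊆𝒟 : 𝒮 ⊆ 𝒟) (δ : Formula) (c : Decodable (! δ)) where

    a b : Atom
    a = flat δ
    b = flat (! δ)

    rule : ∀ {A p} → BoxRule A p → 𝒟 ⟨ A , [] , p ⟩
    rule r = 𝒮⊆𝒟 (box r)

    b-persistent : Persistent 𝒟 b
    b-persistent = ⇒ a , (λ ()) , 𝒮⊆𝒟 (prom δ c)

    b⊢b : Der 𝒟 ([ b ] ++ []) b
    b⊢b = ref ↭-refl

    contract-to-one : ∀ k L {p} → Der 𝒟 (L ++ replicate k b) p → Der 𝒟 (L ++ [ b ]) p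
    contract-to-one zero L {p} d = Der-↭ (app₂ (rule (wk♭ δ p c)) b⊢b d) (↭-++-comm [ b ] L)
    contract-to-one (suc zero) L d = d
    contract-to-one (suc (suc k)) L {p} d =
      contract-to-one (suc k) L (Der-↭ (app₂ (rule (ctr♭ δ p c)) b⊢b (Der-↭ d π₁)) π₂)
      where
      R = replicate k b
      π₁ : L ++ b ∷ b ∷ R ↭ (L ++ R) ++ (b ∷ b ∷ [])
      π₁ = solve 3 (λ x y z → x ∪ (y ∪ (y ∪ z)) ⊜ (x ∪ z) ∪ (y ∪ y)) ↭-refl L [ b ] R
      π₂ : [ b ] ++ (L ++ R) ↭ L ++ b ∷ R
      π₂ = solve 3 (λ x y z → y ∪ (x ∪ z) ⊜ x ∪ (y ∪ z)) ↭-refl L [ b ] R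

    replicate-+ : ∀ m n → replicate (m + n) b ≡ replicate m b ++ replicate n b
    replicate-+ zero n = refl
    replicate-+ (suc m) n = cong (b ∷_) (replicate-+ m n)

    move-b : ∀ C X R → (C ++ [ b ]) ++ (X ++ R) ↭ (C ++ X) ++ (b ∷ R)
    move-b C X R = solve 4 (λ c y x r → (c ∪ y) ∪ (x ∪ r) ⊜ (c ∪ x) ∪ (y ∪ r)) ↭-refl C [ b ] X R

    add-b : AtMS × Atom → AtMS × Atom
    add-b e = (proj₁ e ++ [ b ] , proj₂ e)

    concat-++b : ∀ Cs → concat (map (_++ [ b ]) Cs) ↭ concat Cs ++ replicate (length Cs) b
    concat-++b [] = ↭-refl
    concat-++b (C ∷ Cs) = ↭-trans (++⁺ˡ (C ++ [ b ]) (concat-++b Cs)) (move-b C (concat Cs) _)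

    concat-add-b : ∀ ex → concat (map proj₁ (map add-b ex)) ↭ concat (map proj₁ ex) ++ replicate (length ex) b
    concat-add-b [] = ↭-refl
    concat-add-b ((C , _) ∷ ex) = ↭-trans (++⁺ˡ (C ++ [ b ]) (concat-add-b ex)) (move-b C (concat (map proj₁ ex)) _)

    mutual
      eliminate : ∀ {M q} → Der (withAxiom 𝒟 a) M q → Der 𝒟 (M ++ [ b ]) q
      eliminate {M} {q} (ref e) =
        Der-↭ (app₂ (rule (wk♭ δ q c)) b⊢b (ref (↭-trans (↭-reflexive (++-identityʳ M)) e))) (↭-++-comm [ b ] M)
      -- a use of the axiom becomes a dereliction of b
      eliminate {M} (app _ ex (inj₂ refl) [] al _ e) =
        contract-to-one (suc (length ex)) M
          (Der-↭ (app ([ b ] ∷ [] ∷ []) (map add-b ex) (rule (der♭ δ a c))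
                      (singleBox b⊢b ∷ singleBox (ref ↭-refl) ∷ []) (eliminate-persistent al) (λ ()) ↭-refl) π)
        where
        X = concat (map proj₁ ex)
        R = replicate (length ex) b
        π : b ∷ concat (map proj₁ (map add-b ex)) ↭ M ++ b ∷ R
        π = ↭-trans (prep b (concat-add-b ex)) (↭-trans (↭-sym (shift b X R)) (++⁺ʳ (b ∷ R) (↭-sym e)))
      -- every premise and every persistent extra gets its own copy of b, the new persistent
      -- extra ([ b ] , b) supplies b to the side box, and the copies are then contracted
      eliminate {M} (app {S = S} Cs ex (inj₁ r) pw al sc e) =
        contract-to-one (length Cs + suc (length ex)) M
          (Der-↭ (app (map (_++ [ b ]) Cs) (([ b ] , b) ∷ map add-b ex) r (eliminate-boxes pw)
                      ((b-persistent , ref ↭-refl) ∷ eliminate-persistent al) side ↭-refl) π)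
        where
        side : ∀ {V v} → (V , v) ∈ S → Der 𝒟 (b ∷ map proj₂ (map add-b ex) ++ V) v
        side {V} {v} m = subst (λ Y → Der 𝒟 (b ∷ Y ++ V) v) (map-∘ ex)
          (Der-↭ (eliminate (sc m)) (↭-++-comm (map proj₂ ex ++ V) [ b ]))
        cC = concat Cs
        cE = concat (map proj₁ ex)
        rC = replicate (length Cs) b
        rE = replicate (length ex) b
        π : concat (map (_++ [ b ]) Cs) ++ b ∷ concat (map proj₁ (map add-b ex)) ↭
            M ++ replicate (length Cs + suc (length ex)) b
        π = begin
          concat (map (_++ [ b ]) Cs) ++ b ∷ concat (map proj₁ (map add-b ex))
            ↭⟨ ++⁺ʳ _ (concat-++b Cs) ⟩
          (cC ++ rC) ++ b ∷ concat (map proj₁ (map add-b ex))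
            ↭⟨ ++⁺ˡ (cC ++ rC) (prep b (concat-add-b ex)) ⟩
          (cC ++ rC) ++ b ∷ (cE ++ rE)
            ↭⟨ solve 5 (λ w x y z u → (w ∪ x) ∪ (u ∪ (y ∪ z)) ⊜ (w ∪ y) ∪ (x ∪ (u ∪ z)))
                       ↭-refl cC rC cE rE [ b ] ⟩
          (cC ++ cE) ++ rC ++ b ∷ rE
            ↭⟨ ++⁺ʳ _ (↭-sym e) ⟩
          M ++ rC ++ b ∷ rE
            ≡⟨ cong (M ++_) (replicate-+ (length Cs) (suc (length ex))) ⟨
          M ++ replicate (length Cs + suc (length ex)) b ∎
          where open PermutationReasoning

      eliminate-boxes : ∀ {Cs A} → Pointwise (BoxDer (withAxiom 𝒟 a)) Cs A →
                        Pointwise (BoxDer 𝒟) (map (_++ [ b ]) Cs) A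
      eliminate-boxes [] = []
      eliminate-boxes {C ∷ _} (f ∷ pw) =
        (λ {Q} m → Der-↭ (eliminate (f m))
                         (solve 3 (λ x y z → (x ∪ y) ∪ z ⊜ (x ∪ z) ∪ y) ↭-refl C Q [ b ]))
        ∷ eliminate-boxes pw

      eliminate-persistent : ∀ {ex} → All (PersistentDer (withAxiom 𝒟 a)) ex →
                             All (PersistentDer 𝒟) (map add-b ex)
      eliminate-persistent [] = []
      eliminate-persistent ((pers , d) ∷ al) =
        (persistent-withAxiom {𝒟} pers , eliminate d) ∷ eliminate-persistent al

  Supp⇒Der Der⇒Supp Faithful : Formula → Set₁
  Supp⇒Der χ = ∀ 𝒞 → 𝒮 ⊆ 𝒞 → ∀ L → Supp 𝒞 L χ → Der 𝒞 L (flat χ)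
  Der⇒Supp χ = ∀ 𝒞 → 𝒮 ⊆ 𝒞 → ∀ L → Der 𝒞 L (flat χ) → Supp 𝒞 L χ
  Faithful χ = Supp⇒Der χ × Der⇒Supp χ

  FaithfulBody : Formula → Set₁
  FaithfulBody (! δ) = Faithful δ
  FaithfulBody _ = Lift (lsuc lzero) Unit

  -- What Inf⇒Der needs of each context formula; passed as data so that the mutual recursion of
  -- supp⇒der and der⇒supp stays structural.
  Simulated : Formula → Set₁
  Simulated δ = Decodable δ × Faithful δ × FaithfulBody δ

  data BangView : Formula → Set₂ where
    is-bang  : ∀ ε → BangView (! ε)
    not-bang : ∀ {δ} → item δ ≡ plain (λ 𝒞 K → Supp 𝒞 K δ) → BangView δ

  bangView : ∀ δ → BangView δ
  bangView (atom _) = not-bang refl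
  bangView ⊤ᶠ = not-bang refl
  bangView 𝟘 = not-bang refl
  bangView 𝟙 = not-bang refl
  bangView (φ ⊸ ψ) = not-bang refl
  bangView (φ ⊗ ψ) = not-bang refl
  bangView (φ & ψ) = not-bang refl
  bangView (φ ⊕ ψ) = not-bang refl
  bangView (! ε) = is-bang ε

  banged : List Formula → List Formula
  banged [] = []
  banged (δ ∷ Δ) with bangView δ
  ... | is-bang ε = ε ∷ banged Δ
  ... | not-bang _ = banged Δ

  unbanged : List Formula → List Formula
  unbanged [] = []
  unbanged (δ ∷ Δ) with bangView δ
  ... | is-bang _ = unbanged Δ
  ... | not-bang _ = δ ∷ unbanged Δ

  flat! : Formula → Atom
  flat! ε = flat (! ε)

  flat-split : ∀ Δ → map flat Δ ↭ map flat (unbanged Δ) ++ map flat! (banged Δ)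
  flat-split [] = ↭-refl
  flat-split (δ ∷ Δ) with bangView δ
  ... | is-bang ε = ↭-trans (prep (flat! ε) (flat-split Δ))
                            (↭-sym (shift (flat! ε) (map flat (unbanged Δ)) (map flat! (banged Δ))))
  ... | not-bang _ = prep (flat δ) (flat-split Δ)

  banged-decodable : ∀ Δ → All Simulated Δ → All (λ ε → Decodable (! ε)) (banged Δ)
  banged-decodable [] [] = []
  banged-decodable (δ ∷ Δ) ((c , _) ∷ sims) with bangView δ
  ... | is-bang ε = c ∷ banged-decodable Δ sims
  ... | not-bang _ = banged-decodable Δ sims

  promote : ∀ {ℰ δ} → 𝒮 ⊆ ℰ → Decodable (! δ) → Der ℰ [] (flat δ) → Der ℰ [] (flat (! δ))
  promote {δ = δ} h c d = app [] [] (h (prom δ c)) [] [] (singleBox d) ↭-refl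

  withAxioms : Base → List Formula → Base
  withAxioms ℰ [] = ℰ
  withAxioms ℰ (ε ∷ εs) = withAxiom (withAxioms ℰ εs) (flat ε)

  ⊆-withAxioms : ∀ {ℰ} εs → ℰ ⊆ withAxioms ℰ εs
  ⊆-withAxioms [] r = r
  ⊆-withAxioms (_ ∷ εs) r = inj₁ (⊆-withAxioms εs r)

  axioms : ∀ {ℰ} εs → All (λ ε → Der (withAxioms ℰ εs) [] (flat ε)) εs
  axioms [] = []
  axioms (_ ∷ εs) = axiom ∷ All.map (Der-mono inj₁) (axioms εs)

  eliminate-all : ∀ {ℰ M q} εs → All (λ ε → Decodable (! ε)) εs → 𝒮 ⊆ ℰ →
                  Der (withAxioms ℰ εs) M q → Der ℰ (M ++ map flat! εs) q
  eliminate-all [] _ _ d = Der-++[]⁺ d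
  eliminate-all {ℰ} {M} (ε ∷ εs) (c ∷ cs) h d =
    Der-↭ (eliminate-all εs cs h (eliminate d)) (↭-reflexive (++-assoc M [ flat! ε ] (map flat! εs)))
    where open AxiomElimination (withAxioms ℰ εs) (λ r → ⊆-withAxioms εs (h r)) ε c

  Supports : Base → List AtMS → List (Base → AtMS → Set₁) → Set₂
  Supports ℰ = Pointwise (λ K P → P ℰ K)

  Ders : Base → List AtMS → List Formula → Set₁
  Ders ℰ = Pointwise (λ K δ → Der ℰ K (flat δ))

  Supports⇒CtxSupp : ∀ {ℰ} Ps Ks → Supports ℰ Ks Ps → CtxSupp Ps ℰ (concat Ks)
  Supports⇒CtxSupp [] [] [] = lift ↭-refl
  Supports⇒CtxSupp {ℰ} (P ∷ []) (K ∷ []) (s ∷ []) = subst (P ℰ) (sym (++-identityʳ K)) s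
  Supports⇒CtxSupp (P ∷ Q ∷ Ps) (K ∷ Ks) (s ∷ ss) =
    K , concat Ks , lift ↭-refl , s , Supports⇒CtxSupp (Q ∷ Ps) Ks ss

  CtxSupp⇒Supports : ∀ {ℰ} Ps K → CtxSupp Ps ℰ K →
                      Σ (List AtMS) λ Ks → Supports ℰ Ks Ps × K ↭ concat Ks
  CtxSupp⇒Supports [] K (lift e) = [] , [] , e
  CtxSupp⇒Supports (P ∷ []) K s = [ K ] , s ∷ [] , ↭-reflexive (sym (++-identityʳ K))
  CtxSupp⇒Supports (P ∷ Q ∷ Ps) K (K₁ , M , lift e , s , ss) with CtxSupp⇒Supports (Q ∷ Ps) M ss
  ... | Ks , ss′ , e′ = K₁ ∷ Ks , s ∷ ss′ , ↭-trans e (++⁺ˡ K₁ e′)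

  supports-banged : ∀ Δ → All Simulated Δ → ∀ ℰ → 𝒮 ⊆ ℰ →
                    All (λ ε → Der ℰ [] (flat ε)) (banged Δ) → AllBang (bangs (map item Δ)) ℰ
  supports-banged [] _ ℰ h _ = lift tt
  supports-banged (δ ∷ Δ) (sim ∷ sims) ℰ h ds with bangView δ
  supports-banged (δ ∷ Δ) ((_ , _ , (_ , der⇒supp-ε)) ∷ sims) ℰ h (d ∷ ds) | is-bang ε =
    der⇒supp-ε ℰ h [] d , supports-banged Δ sims ℰ h ds
  supports-banged (δ ∷ Δ) (sim ∷ sims) ℰ h ds | not-bang eq =
    subst (λ i → AllBang (bangs (i ∷ map item Δ)) ℰ) (sym eq) (supports-banged Δ sims ℰ h ds)

  supports-unbanged : ∀ Δ → All Simulated Δ → ∀ ℰ → 𝒮 ⊆ ℰ →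
                      Supports ℰ (map [_] (map flat (unbanged Δ))) (plains (map item Δ))
  supports-unbanged [] _ ℰ h = []
  supports-unbanged (δ ∷ Δ) ((_ , (_ , der⇒supp-δ) , _) ∷ sims) ℰ h with bangView δ
  ... | is-bang _ = supports-unbanged Δ sims ℰ h
  ... | not-bang eq =
    subst (λ i → Supports ℰ ([ flat δ ] ∷ map [_] (map flat (unbanged Δ)))
                           (plains (i ∷ map item Δ)))
          (sym eq) (der⇒supp-δ ℰ h [ flat δ ] (ref ↭-refl) ∷ supports-unbanged Δ sims ℰ h)

  -- Instantiating Δ ⊩ at the base that adds the axioms ⇒ ε♭ for every !ε ∈ Δ, then eliminating them.
  Inf⇒Der : ∀ Δ → All Simulated Δ → ∀ {Q : Base → AtMS → Set₁} {q} →
            (∀ 𝒟 → 𝒮 ⊆ 𝒟 → ∀ K → Q 𝒟 K → Der 𝒟 K q) →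
            ∀ ℰ → 𝒮 ⊆ ℰ → ∀ K → InfG (map item Δ) Q ℰ K → Der ℰ (K ++ map flat Δ) q
  Inf⇒Der [] _ toDer ℰ h K s = Der-++[]⁺ (toDer ℰ h K s)
  Inf⇒Der Δ@(_ ∷ _) sims {Q} {q} toDer ℰ h K s =
    Der-↭ (eliminate-all εs (banged-decodable Δ sims) h (toDer ℱ hℱ (K ++ P) sP)) π
    where
    εs = banged Δ
    ℱ = withAxioms ℰ εs
    hℱ : 𝒮 ⊆ ℱ
    hℱ r = ⊆-withAxioms εs (h r)
    P = map flat (unbanged Δ)
    sP : Q ℱ (K ++ P)
    sP = s ℱ (⊆-withAxioms {ℰ} εs) P (supports-banged Δ sims ℱ hℱ (axioms εs))
           (subst (CtxSupp (plains (map item Δ)) ℱ) (concat-map-[ P ])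
                  (Supports⇒CtxSupp _ _ (supports-unbanged Δ sims ℱ hℱ)))
    π : (K ++ P) ++ map flat! εs ↭ K ++ map flat Δ
    π = ↭-trans (↭-reflexive (++-assoc K P _)) (++⁺ˡ K (↭-sym (flat-split Δ)))

  Supports⇒Ders : ∀ Δ → All Simulated Δ → ∀ ℰ → 𝒮 ⊆ ℰ → ∀ Ks → AllBang (bangs (map item Δ)) ℰ →
                   Supports ℰ Ks (plains (map item Δ)) →
                   Σ (List AtMS) λ Ks′ → Ders ℰ Ks′ Δ × concat Ks ≡ concat Ks′
  Supports⇒Ders [] _ ℰ h [] _ [] = [] , [] , refl
  Supports⇒Ders (δ ∷ Δ) (sim ∷ sims) ℰ h Ks ss ps with bangView δ
  Supports⇒Ders (δ ∷ Δ) ((c , _ , (supp⇒der-ε , _)) ∷ sims) ℰ h Ks (s , ss) ps | is-bang ε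
    with Supports⇒Ders Δ sims ℰ h Ks ss ps
  ... | Ks′ , ds , e = [] ∷ Ks′ , promote h c (supp⇒der-ε ℰ h [] s) ∷ ds , e
  Supports⇒Ders (δ ∷ Δ) ((_ , (supp⇒der-δ , _) , _) ∷ sims) ℰ h Ks ss ps | not-bang eq =
    derive Ks (subst (λ i → Supports ℰ Ks (plains (i ∷ map item Δ))) eq ps)
          (subst (λ i → AllBang (bangs (i ∷ map item Δ)) ℰ) eq ss)
    where
    derive : ∀ Ks → Supports ℰ Ks ((λ 𝒞 K → Supp 𝒞 K δ) ∷ plains (map item Δ)) →
             AllBang (bangs (map item Δ)) ℰ →
             Σ (List AtMS) λ Ks′ → Ders ℰ Ks′ (δ ∷ Δ) × concat Ks ≡ concat Ks′
    derive (K₁ ∷ Ks₁) (s ∷ ps′) ss′ with Supports⇒Ders Δ sims ℰ h Ks₁ ss′ ps′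
    ... | Ks′ , ds , e = K₁ ∷ Ks′ , supp⇒der-δ ℰ h K₁ s ∷ ds , cong (K₁ ++_) e

  CtxSupp⇒Ders : ∀ Δ → All Simulated Δ → ∀ ℰ → 𝒮 ⊆ ℰ → ∀ K → AllBang (bangs (map item Δ)) ℰ →
                 CtxSupp (plains (map item Δ)) ℰ K →
                 Σ (List AtMS) λ Ks → Ders ℰ Ks Δ × K ↭ concat Ks
  CtxSupp⇒Ders Δ sims ℰ h K ss cs with CtxSupp⇒Supports _ K cs
  ... | Ks , ps , e with Supports⇒Ders Δ sims ℰ h Ks ss ps
  ...   | Ks′ , ds , e′ = Ks′ , ds , ↭-trans e (↭-reflexive e′)

  refBoxes : ∀ {ℬ} L → Pointwise (BoxDer ℬ) (map [_] L) (map ⇒_ L)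
  refBoxes [] = []
  refBoxes (_ ∷ L) = singleBox (ref ↭-refl) ∷ refBoxes L

  mutual
    supp⇒der : ∀ χ → Decodable χ → Supp⇒Der χ
    supp⇒der (atom _) _ _ _ _ d = d
    supp⇒der ⊤ᶠ c _ h L _ =
      app (map [_] L) [] (h (box (⊤I♭ L c))) (refBoxes L) [] (λ ())
          (↭-reflexive (sym (trans (++-identityʳ _) concat-map-[ L ])))
    supp⇒der 𝟘 _ _ _ _ s = Der-++[]⁻ (s (flat 𝟘) [])
    supp⇒der 𝟙 c 𝒞 h _ s =
      Der-++[]⁻ (s 𝒞 (λ r → r) [] (flat 𝟙) (app [] [] (h (box (𝟙I♭ c))) [] [] (λ ()) ↭-refl))
    supp⇒der (φ & ψ) c@(_ , cφ , cψ) 𝒞 h L (s₁ , s₂) =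
      app (L ∷ []) [] (h (box (&I♭ φ ψ c))) (both ∷ []) [] (λ ())
          (↭-reflexive (sym (trans (++-identityʳ _) (++-identityʳ L))))
      where
      both : BoxDer 𝒞 L (([] , flat φ) ∷ ([] , flat ψ) ∷ [])
      both (here refl) = Der-++[]⁺ (supp⇒der φ cφ 𝒞 h L s₁)
      both (there (here refl)) = Der-++[]⁺ (supp⇒der ψ cψ 𝒞 h L s₂)
    supp⇒der (φ ⊸ ψ) c@(_ , cφ , cψ) 𝒞 h L s =
      app₁ (h (box (⊸I♭ φ ψ c))) (Inf⇒Der [ φ ] (simulated φ cφ ∷ []) (supp⇒der ψ cψ) 𝒞 h L s)
    supp⇒der (φ ⊗ ψ) c@(_ , cφ , cψ) 𝒞 h _ s = Der-++[]⁻ (s 𝒞 (λ r → r) [] (flat (φ ⊗ ψ)) intro)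
      where
      intro : InfG (item φ ∷ item ψ ∷ []) (λ 𝒟 K → Der 𝒟 K (flat (φ ⊗ ψ))) 𝒞 []
      intro 𝒟 h′ K ss cs
        with CtxSupp⇒Ders (φ ∷ ψ ∷ []) (simulated φ cφ ∷ simulated ψ cψ ∷ []) 𝒟 (λ r → h′ (h r)) K ss cs
      ... | K₁ ∷ K₂ ∷ [] , d₁ ∷ d₂ ∷ [] , e =
        Der-↭ (app₂ (h′ (h (box (⊗I♭ φ ψ c)))) (Der-++[]⁺ d₁) (Der-++[]⁺ d₂))
              (↭-sym (↭-trans e (↭-reflexive (cong (K₁ ++_) (++-identityʳ K₂)))))
    supp⇒der (φ ⊕ ψ) c@(_ , cφ , cψ) 𝒞 h _ s =
      Der-++[]⁻ (s 𝒞 (λ r → r) [] (flat (φ ⊕ ψ)) (intro φ cφ (⊕I₁♭ φ ψ c))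
                                                  (intro ψ cψ (⊕I₂♭ φ ψ c)))
      where
      intro : ∀ χ → Decodable χ → BoxRule [ ⇒ flat χ ] (flat (φ ⊕ ψ)) →
              InfG (item χ ∷ []) (λ 𝒟 K → Der 𝒟 K (flat (φ ⊕ ψ))) 𝒞 []
      intro χ cχ R 𝒟 h′ K ss cs with CtxSupp⇒Ders [ χ ] (simulated χ cχ ∷ []) 𝒟 (λ r → h′ (h r)) K ss cs
      ... | K₁ ∷ [] , d₁ ∷ [] , e =
        Der-↭ (app₁ (h′ (h (box R))) (Der-++[]⁺ d₁)) (↭-sym (↭-trans e (↭-reflexive (++-identityʳ K₁))))
    supp⇒der (! δ) c@(_ , cδ) 𝒞 h _ s =
      Der-++[]⁻ (s 𝒞 (λ r → r) [] (flat (! δ))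
                   (λ ℰ h′ sδ → promote (λ r → h′ (h r)) c (supp⇒der δ cδ ℰ (λ r → h′ (h r)) [] sδ)))

    der⇒supp : ∀ χ → Decodable χ → Der⇒Supp χ
    der⇒supp (atom _) _ _ _ _ d = d
    der⇒supp ⊤ᶠ _ _ _ _ _ = lift tt
    der⇒supp 𝟘 c _ h L d p K =
      app (L ∷ map [_] K) [] (h (box (𝟘E♭ K p c))) (singleBox (Der-++[]⁺ d) ∷ refBoxes K) [] (λ ())
          (↭-reflexive (sym (trans (++-identityʳ _) (cong (L ++_) concat-map-[ K ]))))
    der⇒supp 𝟙 c _ h _ d _ h′ _ p dK =
      app₂ (h′ (h (box (𝟙E♭ p c)))) (Der-++[]⁺ (Der-mono h′ d)) (Der-++[]⁺ dK)
    der⇒supp (φ & ψ) c@(_ , cφ , cψ) 𝒞 h L d =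
      der⇒supp φ cφ 𝒞 h L (app₁ (h (box (&E₁♭ φ ψ c))) (Der-++[]⁺ d)) ,
      der⇒supp ψ cψ 𝒞 h L (app₁ (h (box (&E₂♭ φ ψ c))) (Der-++[]⁺ d))
    der⇒supp (φ ⊸ ψ) c@(_ , cφ , cψ) _ h L d 𝒟 h′ K ss cs
      with CtxSupp⇒Ders [ φ ] (simulated φ cφ ∷ []) 𝒟 (λ r → h′ (h r)) K ss cs
    ... | K₁ ∷ [] , dφ ∷ [] , e =
      der⇒supp ψ cψ 𝒟 (λ r → h′ (h r)) (L ++ K)
        (Der-↭ (app₂ (h′ (h (box (⊸E♭ φ ψ c)))) (Der-++[]⁺ (Der-mono h′ d)) (Der-++[]⁺ dφ))
               (++⁺ˡ L (↭-sym (↭-trans e (↭-reflexive (++-identityʳ K₁))))))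
    der⇒supp (φ ⊗ ψ) c@(_ , cφ , cψ) _ h _ d 𝒟 h′ K p i =
      app₂ (h′ (h (box (⊗E♭ φ ψ p c)))) (Der-++[]⁺ (Der-mono h′ d))
           (Inf⇒Der (φ ∷ ψ ∷ []) (simulated φ cφ ∷ simulated ψ cψ ∷ []) (λ _ _ _ d → d)
                    𝒟 (λ r → h′ (h r)) K i)
    der⇒supp (φ ⊕ ψ) c@(_ , cφ , cψ) _ h L d 𝒟 h′ K p i₁ i₂ =
      app (L ∷ K ∷ []) [] (h′ (h (box (⊕E♭ φ ψ p c))))
          (singleBox (Der-++[]⁺ (Der-mono h′ d)) ∷ cases ∷ [])
          [] (λ ()) (↭-reflexive (sym (trans (++-identityʳ _) (cong (L ++_) (++-identityʳ K)))))
      where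
      cases : BoxDer 𝒟 K (([ flat φ ] , p) ∷ ([ flat ψ ] , p) ∷ [])
      cases (here refl)         = Inf⇒Der [ φ ] (simulated φ cφ ∷ []) (λ _ _ _ d → d) 𝒟 (λ r → h′ (h r)) K i₁
      cases (there (here refl)) = Inf⇒Der [ ψ ] (simulated ψ cψ ∷ []) (λ _ _ _ d → d) 𝒟 (λ r → h′ (h r)) K i₂
    -- ⊩ δ holds in the extension by the axiom ⇒ δ♭; that axiom is then traded for the
    -- hypothesis (!δ)♭, which is cut against d
    der⇒supp (! δ) c@(_ , cδ) _ h _ d 𝒟 h′ K p H =
      app₂ (𝒮⊆𝒟 (box (cut♭ (! δ) p c))) (Der-++[]⁺ (Der-mono h′ d)) (eliminate (H ℰ inj₁ sδ))
      where
      𝒮⊆𝒟 : 𝒮 ⊆ 𝒟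
      𝒮⊆𝒟 r = h′ (h r)
      ℰ = withAxiom 𝒟 (flat δ)
      sδ : Supp ℰ [] δ
      sδ = der⇒supp δ cδ ℰ (λ r → inj₁ (𝒮⊆𝒟 r)) [] axiom
      open AxiomElimination 𝒟 𝒮⊆𝒟 δ c

    faithfulBody : ∀ χ → Decodable χ → FaithfulBody χ
    faithfulBody (atom _) _ = lift tt
    faithfulBody ⊤ᶠ _ = lift tt
    faithfulBody 𝟘 _ = lift tt
    faithfulBody 𝟙 _ = lift tt
    faithfulBody (_ ⊸ _) _ = lift tt
    faithfulBody (_ ⊗ _) _ = lift tt
    faithfulBody (_ & _) _ = lift tt
    faithfulBody (_ ⊕ _) _ = lift tt
    faithfulBody (! ε) (_ , cε) = supp⇒der ε cε , der⇒supp ε cε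

    simulated : ∀ χ → Decodable χ → Simulated χ
    simulated χ c = c , (supp⇒der χ c , der⇒supp χ c) , faithfulBody χ c

  decodeAll-flat : ∀ Γ → All Decodable Γ → decodeAll (map flat Γ) ≡ Γ
  decodeAll-flat [] [] = refl
  decodeAll-flat (_ ∷ Γ) ((o , _) ∷ cs) = cong₂ _∷_ o (decodeAll-flat Γ cs)

  complete : ∀ Γ φ → All Decodable Γ → Decodable φ → Inf 𝒮 [] Γ φ → Γ ⊢ φ
  complete Γ φ cs cφ v = subst₂ _⊢_ (decodeAll-flat Γ cs) (proj₁ cφ)
    (sound (Inf⇒Der Γ (All.map (λ {χ} → simulated χ) cs) (supp⇒der φ cφ) 𝒮 (λ r → r) [] v))

-- Choosing the codes

postfix : Formula → List ℕ
postfix (atom p) = 0 ∷ p ∷ []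
postfix ⊤ᶠ = [ 1 ]
postfix 𝟘 = [ 2 ]
postfix 𝟙 = [ 3 ]
postfix (φ ⊸ ψ) = postfix φ ++ postfix ψ ++ [ 4 ]
postfix (φ ⊗ ψ) = postfix φ ++ postfix ψ ++ [ 5 ]
postfix (φ & ψ) = postfix φ ++ postfix ψ ++ [ 6 ]
postfix (φ ⊕ ψ) = postfix φ ++ postfix ψ ++ [ 7 ]
postfix (! φ) = postfix φ ++ [ 8 ]

-- ill-formed input is skipped; only parse-postfix matters
parse : List ℕ → List Formula → List Formula
parse [] st = st
parse (0 ∷ p ∷ ns) st = parse ns (atom p ∷ st)
parse (1 ∷ ns) st = parse ns (⊤ᶠ ∷ st)
parse (2 ∷ ns) st = parse ns (𝟘 ∷ st)
parse (3 ∷ ns) st = parse ns (𝟙 ∷ st)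
parse (4 ∷ ns) (ψ ∷ φ ∷ st) = parse ns (φ ⊸ ψ ∷ st)
parse (5 ∷ ns) (ψ ∷ φ ∷ st) = parse ns (φ ⊗ ψ ∷ st)
parse (6 ∷ ns) (ψ ∷ φ ∷ st) = parse ns (φ & ψ ∷ st)
parse (7 ∷ ns) (ψ ∷ φ ∷ st) = parse ns (φ ⊕ ψ ∷ st)
parse (8 ∷ ns) (φ ∷ st) = parse ns (! φ ∷ st)
parse (_ ∷ ns) st = parse ns st

mutual
  parse-postfix : ∀ φ ns st → parse (postfix φ ++ ns) st ≡ parse ns (φ ∷ st)
  parse-postfix (atom p) ns st = refl
  parse-postfix ⊤ᶠ ns st = refl
  parse-postfix 𝟘 ns st = refl
  parse-postfix 𝟙 ns st = refl
  parse-postfix (φ ⊸ ψ) = parse-postfix₂ φ ψ 4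
  parse-postfix (φ ⊗ ψ) = parse-postfix₂ φ ψ 5
  parse-postfix (φ & ψ) = parse-postfix₂ φ ψ 6
  parse-postfix (φ ⊕ ψ) = parse-postfix₂ φ ψ 7
  parse-postfix (! φ) ns st = begin
    parse ((postfix φ ++ [ 8 ]) ++ ns) st ≡⟨ cong (λ ms → parse ms st) (++-assoc (postfix φ) _ ns) ⟩
    parse (postfix φ ++ 8 ∷ ns) st        ≡⟨ parse-postfix φ _ st ⟩
    parse (8 ∷ ns) (φ ∷ st)               ∎
    where open ≡-Reasoning

  parse-postfix₂ : ∀ φ ψ t ns st →
                   parse ((postfix φ ++ postfix ψ ++ [ t ]) ++ ns) st ≡ parse (t ∷ ns) (ψ ∷ φ ∷ st)
  parse-postfix₂ φ ψ t ns st = begin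
    parse ((postfix φ ++ postfix ψ ++ [ t ]) ++ ns) st
      ≡⟨ cong (λ ms → parse ms st) (++-assoc (postfix φ) _ ns) ⟩
    parse (postfix φ ++ (postfix ψ ++ [ t ]) ++ ns) st
      ≡⟨ cong (λ ms → parse (postfix φ ++ ms) st) (++-assoc (postfix ψ) _ ns) ⟩
    parse (postfix φ ++ postfix ψ ++ t ∷ ns) st ≡⟨ parse-postfix φ _ st ⟩
    parse (postfix ψ ++ t ∷ ns) (φ ∷ st)       ≡⟨ parse-postfix ψ _ _ ⟩
    parse (t ∷ ns) (ψ ∷ φ ∷ st)                ∎
    where open ≡-Reasoning

postfix-injective : ∀ {φ ψ} → postfix φ ≡ postfix ψ → φ ≡ ψ
postfix-injective {φ} {ψ} e = ∷-injectiveˡ (begin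
  [ φ ]                         ≡⟨ parse-postfix φ [] [] ⟨
  parse (postfix φ ++ []) []    ≡⟨ cong (λ ns → parse (ns ++ []) []) e ⟩
  parse (postfix ψ ++ []) []    ≡⟨ parse-postfix ψ [] [] ⟩
  [ ψ ]                         ∎)
  where open ≡-Reasoning

_≟_ : DecidableEquality Formula
φ ≟ ψ = map′ postfix-injective (cong postfix) (≡-dec _≟ℕ_ (postfix φ) (postfix ψ))

subformulas : Formula → List Formula
subformulas (φ ⊸ ψ) = (φ ⊸ ψ) ∷ subformulas φ ++ subformulas ψ
subformulas (φ ⊗ ψ) = (φ ⊗ ψ) ∷ subformulas φ ++ subformulas ψ
subformulas (φ & ψ) = (φ & ψ) ∷ subformulas φ ++ subformulas ψ
subformulas (φ ⊕ ψ) = (φ ⊕ ψ) ∷ subformulas φ ++ subformulas ψ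
subformulas (! φ) = ! φ ∷ subformulas φ
subformulas χ = [ χ ]

atomOf : Formula → ℕ
atomOf (atom p) = p
atomOf _ = 0

atomBound : List Formula → ℕ
atomBound [] = 0
atomBound (χ ∷ χs) = atomOf χ ⊔ atomBound χs

atom≤atomBound : ∀ {p χs} → atom p ∈ χs → p ≤ atomBound χs
atom≤atomBound {p} {_ ∷ χs} (here refl) = m≤m⊔n p (atomBound χs)
atom≤atomBound {p} {χ ∷ χs} (there m) = ≤-trans (atom≤atomBound m) (m≤n⊔m (atomOf χ) (atomBound χs))

position : Formula → List Formula → ℕ
position χ [] = 0
position χ (ψ ∷ ψs) with ψ ≟ χ
... | yes _ = 0
... | no _ = suc (position χ ψs)

-- lookup that returns the junk value ⊤ᶠ past the end of the list
_‼_ : List Formula → ℕ → Formula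
[] ‼ _ = ⊤ᶠ
(ψ ∷ _) ‼ zero = ψ
(_ ∷ ψs) ‼ suc n = ψs ‼ n

‼-position : ∀ {χ ψs} → χ ∈ ψs → ψs ‼ position χ ψs ≡ χ
‼-position {χ} {ψ ∷ ψs} m with ψ ≟ χ
... | yes e = e
... | no ψ≢χ with m
...   | here e = ⊥-elim (ψ≢χ (sym e))
...   | there m′ = ‼-position m′

-- Atoms below `fresh` stand for themselves; the relevant compound formulae are numbered from `fresh` on.
module Coding (Γ : List Formula) (φ : Formula) where

  relevant : List Formula
  relevant = subformulas φ ++ concatMap subformulas Γ

  fresh : ℕ
  fresh = suc (atomBound relevant)

  code : Formula → Atom
  code χ = fresh + position χ relevant

  decode : Atom → Formula
  decode n with n <? fresh
  ... | yes _ = atom n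
  ... | no _ = relevant ‼ (n ∸ fresh)

  open Simulation code decode public

  decode-code : ∀ {χ} → χ ∈ relevant → decode (code χ) ≡ χ
  decode-code {χ} m with code χ <? fresh
  ... | yes lt = ⊥-elim (m+n≮m fresh _ lt)
  ... | no _ = trans (cong (relevant ‼_) (m+n∸m≡n fresh (position χ relevant))) (‼-position m)

  decode-atom : ∀ {p} → atom p ∈ relevant → decode p ≡ atom p
  decode-atom {p} m with p <? fresh
  ... | yes _ = refl
  ... | no p≮fresh = ⊥-elim (p≮fresh (s≤s (atom≤atomBound m)))

  decodes : ∀ {χ} → χ ∈ relevant → Decodes χ
  decodes {atom _} = decode-atom
  decodes {⊤ᶠ} = decode-code
  decodes {𝟘} = decode-code
  decodes {𝟙} = decode-code
  decodes {_ ⊸ _} = decode-code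
  decodes {_ ⊗ _} = decode-code
  decodes {_ & _} = decode-code
  decodes {_ ⊕ _} = decode-code
  decodes {(! _)} = decode-code

  mutual
    decodable : ∀ χ → (∀ {ψ} → ψ ∈ subformulas χ → ψ ∈ relevant) → Decodable χ
    decodable (atom _) h = decodes (h (here refl)) , tt
    decodable ⊤ᶠ h = decodes (h (here refl)) , tt
    decodable 𝟘 h = decodes (h (here refl)) , tt
    decodable 𝟙 h = decodes (h (here refl)) , tt
    decodable (φ ⊸ ψ) h = decodable-binary φ ψ h
    decodable (φ ⊗ ψ) h = decodable-binary φ ψ h
    decodable (φ & ψ) h = decodable-binary φ ψ h
    decodable (φ ⊕ ψ) h = decodable-binary φ ψ h
    decodable (! φ) h = decodes (h (here refl)) , decodable φ (λ m → h (there m))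

    decodable-binary : ∀ φ ψ {χ} → (∀ {ψ′} → ψ′ ∈ χ ∷ subformulas φ ++ subformulas ψ → ψ′ ∈ relevant) →
                       Decodes χ × Decodable φ × Decodable ψ
    decodable-binary φ ψ h =
      decodes (h (here refl)) ,
      decodable φ (λ m → h (there (∈-++⁺ˡ m))) ,
      decodable ψ (λ m → h (there (∈-++⁺ʳ (subformulas φ) m)))

  decodable-all : ∀ Δ → (∀ {ψ} → ψ ∈ concatMap subformulas Δ → ψ ∈ relevant) → All Decodable Δ
  decodable-all [] h = []
  decodable-all (δ ∷ Δ) h =
    decodable δ (λ m → h (∈-++⁺ˡ m)) ∷ decodable-all Δ (λ m → h (∈-++⁺ʳ (subformulas δ) m))

mainTheorem2 : (Γ : List Formula) (φ : Formula) → Valid Γ φ → Γ ⊢ φ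
mainTheorem2 Γ φ valid =
  complete Γ φ (decodable-all Γ (∈-++⁺ʳ (subformulas φ))) (decodable φ ∈-++⁺ˡ) (valid 𝒮)
  where open Coding Γ φ
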